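{- For every $n\geq 3$, $twin(n)=cousin(n)$, where $twin(n)$ is the number of $n$-totative $t$ with $t+2$ also $n$-totative, and $cousin(n)$ is the number of $n$-totative $t$ with $t+4$ also $n$-totative.
   Context: $p_i$ denotes the $i$th prime. The primorial is $\#(m)=\prod_{i=1}^{m}p_i$. The $m$-primorial set is $\{2,\ldots,\#(m)+1\}$, and an $m$-totative number is an element of it coprime to $\#(m)$. -}

module Defs where

open import Data.Nat using (ℕ; zero; suc; _+_; _*_; _≤_; _≤?_)
open import Data.Nat using (_!)
open import Data.Nat.Primality using (prime?)
open import Data.Nat.Coprimality using (Coprime; coprime?)
open import Data.List using (List; length; filter; map; upTo)
open import Data.Product using (_×_)
open import Relation.Nullary using (Dec; yes; no)
open import Relation.Nullary.Decidable using (_×-dec_)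

-- smallest prime q with  p < q ≤ p + fuel  (fuel-bounded search);
-- with fuel = p ! , Euclid's argument guarantees such a prime exists
-- (some prime factor of p ! + 1 exceeds p), so the fallback is never used.
nextPrimeFrom : ℕ → ℕ → ℕ
nextPrimeFrom p zero = p
nextPrimeFrom p (suc k) with prime? (suc p)
... | yes _ = suc p
... | no  _ = nextPrimeFrom (suc p) k

nextPrime : ℕ → ℕ
nextPrime p = nextPrimeFrom p (p !)

-- p i : the i-th prime, 1-indexed: p 1 = 2, p 2 = 3, ...  (p 0 = 1 is a dummy)
p : ℕ → ℕ
p zero = 1
p (suc zero) = 2
p (suc (suc i)) = nextPrime (p (suc i))

primorial : ℕ → ℕ
primorial zero = 1
primorial (suc m) = primorial m * p (suc m)

primorialSet : ℕ → List ℕ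
primorialSet m = map (2 +_) (upTo (primorial m))

IsTotative : ℕ → ℕ → Set
IsTotative m t = (2 ≤ t × t ≤ primorial m + 1) × Coprime t (primorial m)

totative? : ∀ m t → Dec (IsTotative m t)
totative? m t = ((2 ≤? t) ×-dec (t ≤? primorial m + 1)) ×-dec coprime? t (primorial m)

gapCount : ℕ → ℕ → ℕ
gapCount k m = length (filter (λ t → totative? m t ×-dec totative? m (t + k)) (primorialSet m))

twin : ℕ → ℕ
twin = gapCount 2

cousin : ℕ → ℕ
cousin = gapCount 4

-- With N = #(m) = 2 M and M odd, a = M + 2 and c = (M ^ 2 + 1) / 2 are mutually inverse units
-- modulo N with 2 a ≡ 4 and 4 c ≡ 2. Multiplication by a (resp. c), read back into {2, …, N + 1},
-- therefore maps pairs of totatives at distance 2 injectively to pairs at distance 4 (resp. back).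
-- Since 2, 3, 5 ∣ N for m ≥ 3, no such pair wraps around N + 1, so twin(m) ≤ cousin(m) ≤ twin(m).
module Submission where

open import Data.Empty using (⊥-elim)
open import Data.List using (List; []; _∷_; [_]; length; filter)
open import Data.List.Membership.Propositional using (_∈_; _─_)
open import Data.List.Membership.Propositional.Properties
  using (∈-filter⁺; ∈-filter⁻; ∈-map⁺; ∈-upTo⁺)
open import Data.List.Properties using (length-removeAt′)
open import Data.List.Relation.Unary.All as All using (_∷_)
open import Data.List.Relation.Unary.AllPairs using (_∷_)
open import Data.List.Relation.Unary.Any using (here; there; index)
open import Data.List.Relation.Unary.Unique.Propositional using (Unique)
import Data.List.Relation.Unary.Unique.Propositional.Properties as Unique
open import Data.Nat
open import Data.Nat.Coprimality using (Coprime; coprime-divisor)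
import Data.Nat.Coprimality as Coprime
open import Data.Nat.Divisibility
open import Data.Nat.DivMod
open import Data.Nat.ListAction using (product)
open import Data.Nat.Primality
open import Data.Nat.Primality.Factorisation using (factorise)
open import Data.Nat.Properties
open import Data.Nat.Tactic.RingSolver using (solve)
open import Data.Product using (∃-syntax; _×_; _,_; proj₁; proj₂; map₂)
open import Data.Sum using (inj₁; inj₂)
open import Function using (_∘_)
open import Relation.Nullary using (¬_; yes; no; contradiction)
open import Relation.Nullary.Decidable using (_×-dec_)
open import Relation.Binary.PropositionalEquality
  using (_≡_; _≢_; refl; sym; trans; cong; cong₂; subst; module ≡-Reasoning)
open import Defs

∈-─ : ∀ {A : Set} {x z : A} {ys} (x∈ys : x ∈ ys) → z ∈ ys → z ≢ x → z ∈ ys ─ x∈ys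
∈-─ (here refl) (here refl) z≢x = contradiction refl z≢x
∈-─ (here refl) (there z∈ys) _ = z∈ys
∈-─ (there x∈ys) (here refl) _ = here refl
∈-─ (there x∈ys) (there z∈ys) z≢x = there (∈-─ x∈ys z∈ys z≢x)

module _ {A B : Set} where

  length-≤-by-injection : ∀ (f : A → B) {xs ys} → Unique xs →
    (∀ {x} → x ∈ xs → f x ∈ ys) →
    (∀ {x y} → x ∈ xs → y ∈ xs → f x ≡ f y → x ≡ y) →
    length xs ≤ length ys
  length-≤-by-injection f {[]} _ _ _ = z≤n
  length-≤-by-injection f {x ∷ xs} {ys} (x∉xs ∷ xs!) maps injective =
    ≤-trans (s≤s (length-≤-by-injection f xs! maps′ injective′))
            (≤-reflexive (sym (length-removeAt′ ys (index fx∈ys))))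
    where
    fx∈ys = maps (here refl)
    maps′ : ∀ {z} → z ∈ xs → f z ∈ ys ─ fx∈ys
    maps′ z∈xs = ∈-─ fx∈ys (maps (there z∈xs))
      λ fz≡fx → All.lookup x∉xs z∈xs (sym (injective (there z∈xs) (here refl) fz≡fx))
    injective′ : ∀ {z y} → z ∈ xs → y ∈ xs → f z ≡ f y → z ≡ y
    injective′ z∈xs y∈xs = injective (there z∈xs) (there y∈xs)

m≤n⇒m∣n! : ∀ {m n} → .{{NonZero m}} → m ≤ n → m ∣ n !
m≤n⇒m∣n! {suc m} m≤n = ∣-trans (m∣m*n (m !)) (m≤n⇒m!∣n! m≤n)

-- Euclid: any prime factor of n ! + 1 will do.
∃prime[n<q≤1+n!] : ∀ n → ∃[ q ] Prime q × n < q × q ≤ suc (n !)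
∃prime[n<q≤1+n!] n with factorise (suc (n !))
... | record { factors = [] ; isFactorisation = eq } =
  contradiction (suc-injective eq) (≢-nonZero⁻¹ (n !) {{n !≢0}})
... | record { factors = q ∷ qs ; isFactorisation = eq ; factorsPrime = q-prime ∷ _ } =
  q , q-prime , ≰⇒> q≰n , ∣⇒≤ q∣1+n!
  where
  q∣1+n! : q ∣ suc (n !)
  q∣1+n! = divides (product qs) (trans eq (*-comm q (product qs)))
  q≰n : ¬ q ≤ n
  q≰n q≤n = nonTrivial⇒≢1 {{prime⇒nonTrivial q-prime}}
    (∣1⇒≡1 (∣m+n∣m⇒∣n (subst (q ∣_) (+-comm 1 (n !)) q∣1+n!) (m≤n⇒m∣n! {{prime⇒nonZero q-prime}} q≤n)))

nextPrimeFrom-prime : ∀ c k {q} → Prime q → c < q → q ≤ c + k →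
                      Prime (nextPrimeFrom c k) × c < nextPrimeFrom c k
nextPrimeFrom-prime c zero q-prime c<q q≤c+0 =
  contradiction (≤-trans q≤c+0 (≤-reflexive (+-identityʳ c))) (<⇒≱ c<q)
nextPrimeFrom-prime c (suc k) q-prime c<q q≤c+1+k with prime? (suc c)
... | yes 1+c-prime = 1+c-prime , ≤-refl
... | no 1+c-composite =
  map₂ (<-trans (n<1+n c)) (nextPrimeFrom-prime (suc c) k q-prime 1+c<q (≤-trans q≤c+1+k (≤-reflexive (+-suc c k))))
  where
  1+c<q : suc c < _
  1+c<q = ≤∧≢⇒< c<q λ where refl → 1+c-composite q-prime

nextPrime-prime : ∀ n → .{{NonZero n}} → Prime (nextPrime n) × n < nextPrime n
nextPrime-prime n with ∃prime[n<q≤1+n!] n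
... | q , q-prime , n<q , q≤1+n! =
  nextPrimeFrom-prime n (n !) q-prime n<q (≤-trans q≤1+n! (+-monoˡ-≤ (n !) (>-nonZero⁻¹ n)))

p-prime : ∀ i → Prime (p (suc i))
p-prime zero = prime[2]
p-prime (suc i) = proj₁ (nextPrime-prime _ {{prime⇒nonZero (p-prime i)}})

primorial≢0 : ∀ m → NonZero (primorial m)
primorial≢0 zero = _
primorial≢0 (suc m) = m*n≢0 (primorial m) (p (suc m)) {{primorial≢0 m}} {{prime⇒nonZero (p-prime m)}}

p-odd : ∀ i → ¬ 2 ∣ p (2 + i)
p-odd i 2∣p = prime⇒¬composite (p-prime (suc i)) (hasNonTrivialDivisor 2<p 2∣p)
  where
  2<p : 2 < p (2 + i)
  2<p = ≤-<-trans (nonTrivial⇒n>1 _ {{prime⇒nonTrivial (p-prime i)}})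
                  (proj₂ (nextPrime-prime _ {{prime⇒nonZero (p-prime i)}}))

coprime-* : ∀ {a b n} → Coprime a n → Coprime b n → Coprime (a * b) n
coprime-* a⊥n b⊥n {i} (i∣ab , i∣n) = b⊥n (coprime-divisor i⊥a i∣ab , i∣n)
  where
  i⊥a : Coprime i _
  i⊥a (j∣i , j∣a) = a⊥n (j∣a , ∣-trans j∣i i∣n)

inverse⇒coprime : ∀ {a n} b q → a * b ≡ q * n + 1 → Coprime a n
inverse⇒coprime b q ab≡ {i} (i∣a , i∣n) =
  ∣1⇒≡1 (∣m+n∣m⇒∣n (subst (i ∣_) ab≡ (∣m⇒∣m*n b i∣a)) (∣n⇒∣m*n q i∣n))

module Residues (N : ℕ) .{{_ : NonZero N}} where

  infix 4 _≈_
  _≈_ : ℕ → ℕ → Set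
  x ≈ y = x % N ≡ y % N

  +-multiple-≈ : ∀ x j → x + j * N ≈ x
  +-multiple-≈ x j = [m+kn]%n≡m%n x j N

  ≈-+ʳ : ∀ {x y} z → x ≈ y → x + z ≈ y + z
  ≈-+ʳ {x} {y} z x≈y = begin
    (x + z) % N           ≡⟨ %-distribˡ-+ x z N ⟩
    (x % N + z % N) % N   ≡⟨ cong (λ w → (w + z % N) % N) x≈y ⟩
    (y % N + z % N) % N   ≡⟨ %-distribˡ-+ y z N ⟨
    (y + z) % N           ∎
    where open ≡-Reasoning

  coprime-resp-≈ : ∀ {x y} → x ≈ y → Coprime x N → Coprime y N
  coprime-resp-≈ x≈y x⊥N (i∣y , i∣N) =
    x⊥N (∣n∣m%n⇒∣m i∣N (subst (_ ∣_) (sym x≈y) (%-presˡ-∣ i∣y i∣N)) , i∣N)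

  ≈⇒∣∸ : ∀ {x y} → x ≤ y → x ≈ y → N ∣ y ∸ x
  ≈⇒∣∸ {x} {y} x≤y x≈y = subst (N ∣_) (sym y∸x≡) (n∣m*n (y / N ∸ x / N))
    where
    open ≡-Reasoning
    y∸x≡ : y ∸ x ≡ (y / N ∸ x / N) * N
    y∸x≡ = begin
      y ∸ x                                     ≡⟨ cong₂ _∸_ (m≡m%n+[m/n]*n y N) (m≡m%n+[m/n]*n x N) ⟩
      (y % N + y / N * N) ∸ (x % N + x / N * N) ≡⟨ cong (λ w → (y % N + y / N * N) ∸ (w + x / N * N)) x≈y ⟩
      (y % N + y / N * N) ∸ (y % N + x / N * N) ≡⟨ [m+n]∸[m+o]≡n∸o (y % N) _ _ ⟩
      y / N * N ∸ x / N * N                     ≡⟨ *-distribʳ-∸ N (y / N) (x / N) ⟨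
      (y / N ∸ x / N) * N                       ∎

  ∣∸∧∸<⇒≡ : ∀ {x y} → x ≤ y → y ∸ x < N → N ∣ y ∸ x → x ≡ y
  ∣∸∧∸<⇒≡ {x} {y} x≤y y∸x<N N∣y∸x with y ∸ x in y∸x≡
  ... | zero = ≤-antisym x≤y (m∸n≡0⇒m≤n y∸x≡)
  ... | suc _ = contradiction N∣y∸x (>⇒∤ y∸x<N)

  coprime-*-cancelˡ-≈ : ∀ {a x y} → Coprime a N → x ≤ y → a * x ≈ a * y → N ∣ y ∸ x
  coprime-*-cancelˡ-≈ {a} {x} {y} a⊥N x≤y ax≈ay =
    coprime-divisor (Coprime.sym a⊥N)
      (subst (N ∣_) (sym (*-distribˡ-∸ a y x)) (≈⇒∣∸ (*-monoʳ-≤ a x≤y) ax≈ay))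

  rep : ℕ → ℕ
  rep x = 2 + ((N ∸ 2) + x) % N

  rep≤N+1 : ∀ x → rep x ≤ N + 1
  rep≤N+1 x = ≤-trans (s≤s (m%n<n ((N ∸ 2) + x) N)) (≤-reflexive (+-comm 1 N))

  rep-≈ : 2 ≤ N → ∀ x → rep x ≈ x
  rep-≈ 2≤N x = begin
    rep x % N              ≡⟨ %-distribˡ-+ 2 (y % N) N ⟩
    (2 % N + y % N % N) % N ≡⟨ cong (λ w → (2 % N + w) % N) (m%n%n≡m%n y N) ⟩
    (2 % N + y % N) % N    ≡⟨ %-distribˡ-+ 2 y N ⟨
    (2 + y) % N            ≡⟨ cong (_% N) (trans (sym (+-assoc 2 (N ∸ 2) x)) (cong (_+ x) (m+[n∸m]≡n 2≤N))) ⟩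
    (N + x) % N            ≡⟨ %-remove-+ˡ x ∣-refl ⟩
    x % N                  ∎
    where
    open ≡-Reasoning
    y = (N ∸ 2) + x

  y∸x<N : ∀ {x y} → 2 ≤ x → y ≤ N + 1 → y ∸ x < N
  y∸x<N {x} {y} 2≤x y≤N+1 = m<n+o⇒m∸n<o y x (begin-strict
    y      ≤⟨ y≤N+1 ⟩
    N + 1  <⟨ +-monoʳ-< N (s≤s (s≤s z≤n)) ⟩
    N + 2  ≤⟨ +-monoʳ-≤ N 2≤x ⟩
    N + x  ≡⟨ +-comm N x ⟩
    x + N  ∎)
    where open ≤-Reasoning

  coprime-*-injective-on-range : ∀ {a x y} → Coprime a N →
    2 ≤ x → x ≤ N + 1 → 2 ≤ y → y ≤ N + 1 → a * x ≈ a * y → x ≡ y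
  coprime-*-injective-on-range a⊥N 2≤x x≤N+1 2≤y y≤N+1 ax≈ay with ≤-total _ _
  ... | inj₁ x≤y = ∣∸∧∸<⇒≡ x≤y (y∸x<N 2≤x y≤N+1) (coprime-*-cancelˡ-≈ a⊥N x≤y ax≈ay)
  ... | inj₂ y≤x = sym (∣∸∧∸<⇒≡ y≤x (y∸x<N 2≤y x≤N+1) (coprime-*-cancelˡ-≈ a⊥N y≤x (sym ax≈ay)))

rep∈primorialSet : ∀ m x → Residues.rep (primorial m) {{primorial≢0 m}} x ∈ primorialSet m
rep∈primorialSet m x = ∈-map⁺ (2 +_) (∈-upTo⁺ (m%n<n _ (primorial m) {{primorial≢0 m}}))

gapPairs : ℕ → ℕ → List ℕ
gapPairs k m = filter (λ t → totative? m t ×-dec totative? m (t + k)) (primorialSet m)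

gapPairs-unique : ∀ k m → Unique (gapPairs k m)
gapPairs-unique k m = Unique.filter⁺ _ (Unique.map⁺ (+-cancelˡ-≡ 2 _ _) (Unique.upTo⁺ (primorial m)))

∈-gapPairs⁻ : ∀ k m {t} → t ∈ gapPairs k m → IsTotative m t × IsTotative m (t + k)
∈-gapPairs⁻ k m = proj₂ ∘ ∈-filter⁻ _ {xs = primorialSet m}

∈-gapPairs⁺ : ∀ k m {t} → t ∈ primorialSet m → IsTotative m t → IsTotative m (t + k) → t ∈ gapPairs k m
∈-gapPairs⁺ k m t∈ t-tot t+k-tot = ∈-filter⁺ _ {xs = primorialSet m} t∈ (t-tot , t+k-tot)

-- No s, s + k coprime to N with s ≤ N + 1 < s + k (encoded as s + d ≡ N + 1 with d < k).
NoWrap : ℕ → ℕ → Set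
NoWrap N k = ∀ {s d} → d < k → s + d ≡ N + 1 → Coprime s N → ¬ Coprime (s + k) N

noWrap⇒≤ : ∀ {N k s} → NoWrap N k → s ≤ N + 1 → Coprime s N → Coprime (s + k) N → s + k ≤ N + 1
noWrap⇒≤ {N} {k} {s} noWrap s≤N+1 s⊥N s+k⊥N with s + k ≤? N + 1
... | yes s+k≤N+1 = s+k≤N+1
... | no s+k≰N+1 = ⊥-elim (noWrap d<k (m+[n∸m]≡n s≤N+1) s⊥N s+k⊥N)
  where
  d<k : N + 1 ∸ s < k
  d<k = +-cancelˡ-< s _ _ (subst (_< s + k) (sym (m+[n∸m]≡n s≤N+1)) (≰⇒> s+k≰N+1))

divisor-¬coprime : ∀ {q x N} → .{{NonTrivial q}} → q ∣ x → q ∣ N → ¬ Coprime x N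
divisor-¬coprime q∣x q∣N x⊥N = nonTrivial⇒≢1 (x⊥N (q∣x , q∣N))

s+d≡N+1⇒s+[d+j]≡N+1+j : ∀ s {d N} → s + d ≡ N + 1 → ∀ j → s + (d + j) ≡ N + suc j
s+d≡N+1⇒s+[d+j]≡N+1+j s {d} {N} s+d≡ j = trans (sym (+-assoc s d j)) (trans (cong (_+ j) s+d≡) (+-assoc N 1 j))

noWrap-2 : ∀ {N} → 2 ∣ N → 3 ∣ N → NoWrap N 2
noWrap-2 2∣N 3∣N {s} {0} _ s≡ _ =
  divisor-¬coprime (subst (3 ∣_) (sym (s+d≡N+1⇒s+[d+j]≡N+1+j s s≡ 2)) (∣m∣n⇒∣m+n 3∣N ∣-refl)) 3∣N
noWrap-2 {N} 2∣N 3∣N {s} {1} _ s+1≡ s⊥N _ =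
  divisor-¬coprime (subst (2 ∣_) (sym (+-cancelʳ-≡ 1 s N s+1≡)) 2∣N) 2∣N s⊥N
noWrap-2 _ _ {d = 2+ _} (s≤s (s≤s ()))

noWrap-4 : ∀ {N} → 2 ∣ N → 3 ∣ N → 5 ∣ N → NoWrap N 4
noWrap-4 2∣N 3∣N 5∣N {s} {0} _ s≡ _ =
  divisor-¬coprime (subst (5 ∣_) (sym (s+d≡N+1⇒s+[d+j]≡N+1+j s s≡ 4)) (∣m∣n⇒∣m+n 5∣N ∣-refl)) 5∣N
noWrap-4 {N} 2∣N 3∣N 5∣N {s} {1} _ s+1≡ s⊥N _ =
  divisor-¬coprime (subst (2 ∣_) (sym (+-cancelʳ-≡ 1 s N s+1≡)) 2∣N) 2∣N s⊥N
noWrap-4 2∣N 3∣N 5∣N {s} {2} _ s+2≡ _ =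
  divisor-¬coprime (subst (3 ∣_) (sym (s+d≡N+1⇒s+[d+j]≡N+1+j s s+2≡ 2)) (∣m∣n⇒∣m+n 3∣N ∣-refl)) 3∣N
noWrap-4 {N} 2∣N 3∣N 5∣N {s} {3} _ s+3≡ s⊥N _ = divisor-¬coprime 2∣s 2∣N s⊥N
  where
  s+2≡N : s + 2 ≡ N
  s+2≡N = +-cancelʳ-≡ 1 (s + 2) N (trans (+-assoc s 2 1) s+3≡)
  2∣s : 2 ∣ s
  2∣s = ∣m+n∣m⇒∣n (subst (2 ∣_) (trans (sym s+2≡N) (+-comm s 2)) 2∣N) ∣-refl
noWrap-4 _ _ _ {d = 2+ (2+ _)} (s≤s (s≤s (s≤s (s≤s ()))))

gapCount-mono : ∀ m k k′ a j → 2 ≤ primorial m → Coprime a (primorial m) →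
                a * k ≡ k′ + j * primorial m → NoWrap (primorial m) k′ →
                gapCount k m ≤ gapCount k′ m
gapCount-mono m k k′ a j 2≤N a⊥N ak≡ noWrap =
  length-≤-by-injection f (gapPairs-unique k m) f-maps f-injective
  where
  N = primorial m
  instance
    N≢0 : NonZero N
    N≢0 = primorial≢0 m
  open Residues N

  f : ℕ → ℕ
  f t = rep (a * t)

  f-maps : ∀ {t} → t ∈ gapPairs k m → f t ∈ gapPairs k′ m
  f-maps {t} t∈ with ∈-gapPairs⁻ k m t∈
  ... | (_ , t⊥N) , (_ , t+k⊥N) =
    ∈-gapPairs⁺ k′ m (rep∈primorialSet m (a * t))
      ((2≤f , rep≤N+1 (a * t)) , ft⊥N)
      ((≤-trans 2≤f (m≤m+n (f t) k′) , noWrap⇒≤ noWrap (rep≤N+1 (a * t)) ft⊥N ft+k′⊥N) , ft+k′⊥N)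
    where
    2≤f : 2 ≤ f t
    2≤f = m≤m+n 2 _
    ft⊥N : Coprime (f t) N
    ft⊥N = coprime-resp-≈ (sym (rep-≈ 2≤N (a * t))) (coprime-* a⊥N t⊥N)
    a[t+k]≈ft+k′ : a * (t + k) ≈ f t + k′
    a[t+k]≈ft+k′ = begin
      a * (t + k) % N            ≡⟨ cong (_% N) a[t+k]≡ ⟩
      (a * t + k′ + j * N) % N   ≡⟨ +-multiple-≈ (a * t + k′) j ⟩
      (a * t + k′) % N           ≡⟨ ≈-+ʳ k′ (rep-≈ 2≤N (a * t)) ⟨
      (f t + k′) % N             ∎
      where
      open ≡-Reasoning
      a[t+k]≡ : a * (t + k) ≡ a * t + k′ + j * N
      a[t+k]≡ = trans (*-distribˡ-+ a t k) (trans (cong (a * t +_) ak≡) (sym (+-assoc (a * t) k′ _)))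
    ft+k′⊥N : Coprime (f t + k′) N
    ft+k′⊥N = coprime-resp-≈ a[t+k]≈ft+k′ (coprime-* a⊥N t+k⊥N)

  f-injective : ∀ {x y} → x ∈ gapPairs k m → y ∈ gapPairs k m → f x ≡ f y → x ≡ y
  f-injective {x} {y} x∈ y∈ fx≡fy with ∈-gapPairs⁻ k m x∈ | ∈-gapPairs⁻ k m y∈
  ... | ((2≤x , x≤N+1) , _) , _ | ((2≤y , y≤N+1) , _) , _ =
    coprime-*-injective-on-range a⊥N 2≤x x≤N+1 2≤y y≤N+1 (begin
      a * x % N     ≡⟨ rep-≈ 2≤N (a * x) ⟨
      f x % N       ≡⟨ cong (_% N) fx≡fy ⟩
      f y % N       ≡⟨ rep-≈ 2≤N (a * y) ⟩
      a * y % N     ∎)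
    where open ≡-Reasoning

oddPrimorial : ℕ → ℕ
oddPrimorial zero = 1
oddPrimorial (suc m) = oddPrimorial m * p (2 + m)

primorial-suc : ∀ m → primorial (suc m) ≡ 2 * oddPrimorial m
primorial-suc zero = refl
primorial-suc (suc m) = trans (cong (_* p (2 + m)) (primorial-suc m)) (*-assoc 2 (oddPrimorial m) _)

oddPrimorial-odd : ∀ m → ¬ 2 ∣ oddPrimorial m
oddPrimorial-odd zero 2∣1 = contradiction (∣1⇒≡1 2∣1) λ ()
oddPrimorial-odd (suc m) 2∣M*p with euclidsLemma (oddPrimorial m) (p (2 + m)) prime[2] 2∣M*p
... | inj₁ 2∣M = oddPrimorial-odd m 2∣M
... | inj₂ 2∣p = p-odd m 2∣p

odd⇒≡1+2* : ∀ {n} → ¬ 2 ∣ n → ∃[ r ] n ≡ 1 + 2 * r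
odd⇒≡1+2* {0} 2∤0 = contradiction (2 ∣0) 2∤0
odd⇒≡1+2* {1} _ = 0 , refl
odd⇒≡1+2* {suc (suc n)} 2∤2+n with odd⇒≡1+2* {n} (λ 2∣n → 2∤2+n (∣m∣n⇒∣m+n (∣-refl {2}) 2∣n))
... | r , n≡1+2r = suc r , cong (2 +_) (trans n≡1+2r (sym (+-suc r (r + 0))))

30∣primorial : ∀ {n} → 3 ≤ n → 30 ∣ primorial n
30∣primorial {1} (s≤s ())
30∣primorial {2} (s≤s (s≤s ()))
30∣primorial {3} _ = ∣-refl
30∣primorial {suc n@(suc (suc (suc _)))} _ = ∣m⇒∣m*n _ (30∣primorial {n} (s≤s (s≤s (s≤s z≤n))))

-- a = M + 2 = 3 + 2 r and c = (M ^ 2 + 1) / 2 = 1 + 2 r (1 + r), where M = 1 + 2 r.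
[3+2r]*2≡4+N : ∀ {N} r → N ≡ 2 * (1 + 2 * r) → (3 + 2 * r) * 2 ≡ 4 + 1 * N
[3+2r]*2≡4+N r refl = solve [ r ]

[1+2r[1+r]]*4≡2+[1+2r]N : ∀ {N} r → N ≡ 2 * (1 + 2 * r) →
                          (1 + 2 * (r * (1 + r))) * 4 ≡ 2 + (1 + 2 * r) * N
[1+2r[1+r]]*4≡2+[1+2r]N r refl = solve [ r ]

[3+2r]*[1+2r[1+r]]≡[1+r]²N+1 : ∀ {N} r → N ≡ 2 * (1 + 2 * r) →
                               (3 + 2 * r) * (1 + 2 * (r * (1 + r))) ≡ (1 + r) * (1 + r) * N + 1
[3+2r]*[1+2r[1+r]]≡[1+r]²N+1 r refl = solve [ r ]

twin≡cousin-if-primorial≡2[1+2r] : ∀ m r → primorial m ≡ 2 * (1 + 2 * r) → 30 ∣ primorial m → twin m ≡ cousin m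
twin≡cousin-if-primorial≡2[1+2r] m r N≡ 30∣N = ≤-antisym
  (gapCount-mono m 2 4 a 1 2≤N a⊥N ([3+2r]*2≡4+N r N≡) (noWrap-4 2∣N 3∣N 5∣N))
  (gapCount-mono m 4 2 c (1 + 2 * r) 2≤N c⊥N ([1+2r[1+r]]*4≡2+[1+2r]N r N≡) (noWrap-2 2∣N 3∣N))
  where
  a c : ℕ
  a = 3 + 2 * r
  c = 1 + 2 * (r * (1 + r))
  a⊥N : Coprime a (primorial m)
  a⊥N = inverse⇒coprime c ((1 + r) * (1 + r)) ([3+2r]*[1+2r[1+r]]≡[1+r]²N+1 r N≡)
  c⊥N : Coprime c (primorial m)
  c⊥N = inverse⇒coprime a ((1 + r) * (1 + r)) (trans (*-comm c a) ([3+2r]*[1+2r[1+r]]≡[1+r]²N+1 r N≡))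
  2∣N : 2 ∣ primorial m
  2∣N = ∣-trans (divides 15 refl) 30∣N
  3∣N : 3 ∣ primorial m
  3∣N = ∣-trans (divides 10 refl) 30∣N
  5∣N : 5 ∣ primorial m
  5∣N = ∣-trans (divides 6 refl) 30∣N
  2≤N : 2 ≤ primorial m
  2≤N = ∣⇒≤ {{primorial≢0 m}} 2∣N

corollary4 : (n : ℕ) → 3 ≤ n → twin n ≡ cousin n
corollary4 (suc n) 3≤1+n with odd⇒≡1+2* (oddPrimorial-odd n)
... | r , M≡1+2r = twin≡cousin-if-primorial≡2[1+2r] (suc n) r (trans (primorial-suc n) (cong (2 *_) M≡1+2r)) (30∣primorial 3≤1+n)
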